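{- Let $G=(V,E,L)$ be a looped simple graph, $t>1$ an integer, and $f_1$ the function defined below. Suppose $T_1,T_2\subseteq E\cup L$ are sets, each of which spans at least $2t+1$ vertices or contains a loop, and $T_1\cap T_2\neq\emptyset$. Then $f_1(T_1)+f_1(T_2)\geq f_1(T_1\cup T_2)+f_1(T_1\cap T_2)$.
   Context: A looped simple graph $G=(V,E,L)$ has vertex set $V$, simple edges $E$ (no multiple edges) and loops $L$. For $T\subseteq E\cup L$, $V(T)$ is the set of vertices incident to members of $T$ ("$T$ spans $|V(T)|$ vertices"). For an integer $t>1$, $f_1:2^{E\cup L}\to\mathbb{Z}$ is defined by: $f_1(T)=|T|$ if $T\subseteq E$ and $|V(T)|\leq 2t$; $f_1(T)=t|V(T)|-1$ if $T\subseteq E$ and $|V(T)|=2t+1$; $f_1(T)=t|V(T)|$ if ($T\subseteq E$ and $|V(T)|\geq 2t+2$) or $T\cap L\neq\emptyset$. -}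

module Defs where

open import Data.Nat using (ℕ; zero; suc; _+_; _*_; _≤ᵇ_; _≡ᵇ_)
open import Data.Fin using (Fin; toℕ)
open import Data.Bool using (Bool; true; false; _∧_; _∨_; if_then_else_)
open import Data.Integer using (ℤ; +_; _-_)
open import Data.Product using (Σ; _×_; ∃)
open import Relation.Binary.PropositionalEquality using (_≡_)

-- A looped simple graph on vertex set Fin n is encoded by a Boolean relation
-- G : Fin n → Fin n → Bool, of which only the entries with i ≤ j matter:
-- an entry (i , j) with i < j is the simple edge {i , j}, an entry (v , v) is
-- the loop at v.  (Simple: each unordered pair occurs at most once.)
-- A set of edges/loops T ⊆ E ∪ L is encoded the same way.
EdgeLoopSet : ℕ → Set
EdgeLoopSet n = Fin n → Fin n → Bool

_≤F_ : ∀ {n} → Fin n → Fin n → Bool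
i ≤F j = toℕ i ≤ᵇ toℕ j

Mem : ∀ {n} → EdgeLoopSet n → Fin n → Fin n → Set
Mem T i j = ((i ≤F j) ∧ T i j) ≡ true

_⊆ₑ_ : ∀ {n} → EdgeLoopSet n → EdgeLoopSet n → Set
T ⊆ₑ S = ∀ i j → Mem T i j → Mem S i j

_∪ₑ_ : ∀ {n} → EdgeLoopSet n → EdgeLoopSet n → EdgeLoopSet n
(T ∪ₑ S) i j = T i j ∨ S i j

_∩ₑ_ : ∀ {n} → EdgeLoopSet n → EdgeLoopSet n → EdgeLoopSet n
(T ∩ₑ S) i j = T i j ∧ S i j

anyFin : ∀ {n} → (Fin n → Bool) → Bool
anyFin {zero}  p = false
anyFin {suc n} p = p Fin.zero ∨ anyFin (λ i → p (Fin.suc i))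

countFin : ∀ {n} → (Fin n → Bool) → ℕ
countFin {zero}  p = 0
countFin {suc n} p = (if p Fin.zero then 1 else 0) + countFin (λ i → p (Fin.suc i))

sumFin : ∀ {n} → (Fin n → ℕ) → ℕ
sumFin {zero}  f = 0
sumFin {suc n} f = f Fin.zero + sumFin (λ i → f (Fin.suc i))

card : ∀ {n} → EdgeLoopSet n → ℕ
card T = sumFin (λ i → countFin (λ j → (i ≤F j) ∧ T i j))

incident : ∀ {n} → EdgeLoopSet n → Fin n → Bool
incident T v = anyFin (λ u → ((u ≤F v) ∧ T u v) ∨ ((v ≤F u) ∧ T v u))

nV : ∀ {n} → EdgeLoopSet n → ℕ
nV T = countFin (incident T)

hasLoopᵇ : ∀ {n} → EdgeLoopSet n → Bool
hasLoopᵇ T = anyFin (λ v → T v v)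

HasLoop : ∀ {n} → EdgeLoopSet n → Set
HasLoop T = ∃ λ v → T v v ≡ true

NonEmpty : ∀ {n} → EdgeLoopSet n → Set
NonEmpty T = ∃ λ i → ∃ λ j → Mem T i j

f₁ : ℕ → ∀ {n} → EdgeLoopSet n → ℤ
f₁ t T =
  if hasLoopᵇ T then + (t * nV T)
  else if nV T ≤ᵇ (2 * t) then + card T
  else if nV T ≡ᵇ suc (2 * t) then + (t * nV T) - + 1
  else + (t * nV T)

-- For T spanning at least 2t+1 vertices or containing a loop, f₁(T) = t·|V(T)|, except that
-- f₁(T) = t·|V(T)| − 1 when T is loopless on exactly 2t+1 vertices. The inequality holds for
-- t·|V(·)| because |V(T₁ ∪ T₂)| + |V(T₁ ∩ T₂)| ≤ |V(T₁)| + |V(T₂)|, so it remains to compare the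
-- defects t·|V(T)| − f₁(T), which are at most 1 for T₁ and T₂ and at least 0 for the union.
-- Split on I = T₁ ∩ T₂. If I has a loop or spans more than 2t+1 vertices, so do T₁ and T₂, and
-- no defects occur. If I spans k ≤ 2t vertices, it is a nonempty simple graph, so
-- f₁(I) = |I| ≤ k(k−1)/2 ≤ tk − 2 and the defect of I pays for both T₁ and T₂. If I spans
-- exactly 2t+1 vertices, its defect pays for one of T₁, T₂; if both are loopless on 2t+1
-- vertices, then so is the union, and its defect pays for the other.

module Submission where

open import Defs
open import Data.Nat using (ℕ; _<_; _≤_; _*_; suc)
open import Data.Sum using (_⊎_; inj₁; inj₂)

-- A module of its own, so that the ℕ operators opened inside do not clash with the ℤ ones of lemma3p3.
module _ where
  open import Algebra.Bundles using (CommutativeMonoid)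
  open import Data.Bool using (Bool; true; false; _∧_; _∨_; if_then_else_)
  open import Data.Bool.Properties
    using (T-≡; ∧-distribˡ-∨; ∧-conicalˡ; ∧-conicalʳ; ∨-conicalˡ; ∨-conicalʳ;
           ∨-commutativeMonoid)
  open import Data.Empty using (⊥-elim)
  open import Data.Fin using (Fin; zero; suc; toℕ)
  import Data.Integer as ℤ
  open import Data.Integer.Properties using (⊖-≥)
  open import Data.Nat using (zero; _+_; _∸_; _≤ᵇ_; _≡ᵇ_; z≤n; s≤s)
  open import Data.Nat.Properties
  open import Data.Nat.Tactic.RingSolver using (solve-∀)
  open import Data.Product using (_,_)
  open import Function.Bundles using (Equivalence)
  open import Relation.Binary.Definitions using (tri<; tri≈; tri>)
  open import Relation.Nullary using (¬_)
  open import Relation.Binary.PropositionalEquality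
  open import Algebra.Properties.CommutativeSemigroup
    (CommutativeMonoid.commutativeSemigroup ∨-commutativeMonoid)
    using () renaming (interchange to ∨-interchange)
  open import Algebra.Properties.CommutativeSemigroup +-commutativeSemigroup
    using () renaming (interchange to +-interchange; xy∙z≈xz∙y to [m+n]+o≡[m+o]+n)

  _⇒ᵇ_ : Bool → Bool → Set
  a ⇒ᵇ b = a ≡ true → b ≡ true

  ∨-true-introˡ : ∀ {a} b → a ≡ true → a ∨ b ≡ true
  ∨-true-introˡ b refl = refl

  ∨-true-introʳ : ∀ a {b} → b ≡ true → a ∨ b ≡ true
  ∨-true-introʳ true  _ = refl
  ∨-true-introʳ false e = e

  ∨-mono-⇒ᵇ : ∀ {a b c d} → a ⇒ᵇ c → b ⇒ᵇ d → (a ∨ b) ⇒ᵇ (c ∨ d)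
  ∨-mono-⇒ᵇ {true}  {_} {c} a⇒c _ _ = ∨-true-introˡ _ (a⇒c refl)
  ∨-mono-⇒ᵇ {false} {_} {c} _ b⇒d e = ∨-true-introʳ c (b⇒d e)

  ∧-monoʳ-⇒ᵇ : ∀ a {b c} → b ⇒ᵇ c → (a ∧ b) ⇒ᵇ (a ∧ c)
  ∧-monoʳ-⇒ᵇ true b⇒c = b⇒c

  fromBool : Bool → ℕ
  fromBool b = if b then 1 else 0

  fromBool-mono : ∀ {a b} → a ⇒ᵇ b → fromBool a ≤ fromBool b
  fromBool-mono {false} _   = z≤n
  fromBool-mono {true}  a⇒b rewrite a⇒b refl = ≤-refl

  fromBool-∨+∧ : ∀ a b → fromBool (a ∨ b) + fromBool (a ∧ b) ≡ fromBool a + fromBool b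
  fromBool-∨+∧ true  true  = refl
  fromBool-∨+∧ true  false = refl
  fromBool-∨+∧ false true  = refl
  fromBool-∨+∧ false false = refl

  anyFin-intro : ∀ {n} (p : Fin n → Bool) i → p i ≡ true → anyFin p ≡ true
  anyFin-intro p zero    e = ∨-true-introˡ _ e
  anyFin-intro p (suc i) e = ∨-true-introʳ (p zero) (anyFin-intro (λ j → p (suc j)) i e)

  anyFin-mono : ∀ {n} {p q : Fin n → Bool} → (∀ i → p i ⇒ᵇ q i) → anyFin p ⇒ᵇ anyFin q
  anyFin-mono {zero}  p⇒q ()
  anyFin-mono {suc n} p⇒q = ∨-mono-⇒ᵇ (p⇒q zero) (anyFin-mono (λ i → p⇒q (suc i)))

  anyFin-∨ : ∀ {n} (p q : Fin n → Bool) → anyFin (λ i → p i ∨ q i) ≡ anyFin p ∨ anyFin q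
  anyFin-∨ {zero}  p q = refl
  anyFin-∨ {suc n} p q = begin
    (p zero ∨ q zero) ∨ anyFin (λ i → p (suc i) ∨ q (suc i))
      ≡⟨ cong ((p zero ∨ q zero) ∨_) (anyFin-∨ (λ i → p (suc i)) (λ i → q (suc i))) ⟩
    (p zero ∨ q zero) ∨ (anyFin (λ i → p (suc i)) ∨ anyFin (λ i → q (suc i)))
      ≡⟨ ∨-interchange (p zero) (q zero) _ _ ⟩
    anyFin p ∨ anyFin q ∎
    where open ≡-Reasoning

  countFin-cong : ∀ {n} {p q : Fin n → Bool} → (∀ i → p i ≡ q i) → countFin p ≡ countFin q
  countFin-cong {zero}  p≡q = refl
  countFin-cong {suc n} p≡q =
    cong₂ _+_ (cong fromBool (p≡q zero)) (countFin-cong (λ i → p≡q (suc i)))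

  countFin-mono : ∀ {n} {p q : Fin n → Bool} → (∀ i → p i ⇒ᵇ q i) → countFin p ≤ countFin q
  countFin-mono {zero}  p⇒q = z≤n
  countFin-mono {suc n} p⇒q =
    +-mono-≤ (fromBool-mono (p⇒q zero)) (countFin-mono (λ i → p⇒q (suc i)))

  countFin-∨+∧ : ∀ {n} (p q : Fin n → Bool) →
    countFin (λ i → p i ∨ q i) + countFin (λ i → p i ∧ q i) ≡ countFin p + countFin q
  countFin-∨+∧ {zero}  p q = refl
  countFin-∨+∧ {suc n} p q = begin
    (fromBool (p zero ∨ q zero) + countFin (λ i → p (suc i) ∨ q (suc i)))
      + (fromBool (p zero ∧ q zero) + countFin (λ i → p (suc i) ∧ q (suc i)))
      ≡⟨ +-interchange (fromBool (p zero ∨ q zero)) _ _ _ ⟩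
    (fromBool (p zero ∨ q zero) + fromBool (p zero ∧ q zero))
      + (countFin (λ i → p (suc i) ∨ q (suc i)) + countFin (λ i → p (suc i) ∧ q (suc i)))
      ≡⟨ cong₂ _+_ (fromBool-∨+∧ (p zero) (q zero))
                   (countFin-∨+∧ (λ i → p (suc i)) (λ i → q (suc i))) ⟩
    (fromBool (p zero) + fromBool (q zero))
      + (countFin (λ i → p (suc i)) + countFin (λ i → q (suc i)))
      ≡⟨ +-interchange (fromBool (p zero)) _ _ _ ⟩
    countFin p + countFin q ∎
    where open ≡-Reasoning

  countFin-pos : ∀ {n} (p : Fin n → Bool) i → p i ≡ true → 1 ≤ countFin p
  countFin-pos p zero    e rewrite e = s≤s z≤n
  countFin-pos p (suc i) e =
    ≤-trans (countFin-pos (λ j → p (suc j)) i e) (m≤n+m _ (fromBool (p zero)))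

  countFin-none : ∀ {n} (p : Fin n → Bool) → anyFin p ≡ false → countFin p ≡ 0
  countFin-none {zero}  p _ = refl
  countFin-none {suc n} p e rewrite ∨-conicalˡ (p zero) _ e =
    countFin-none (λ i → p (suc i)) (∨-conicalʳ (p zero) _ e)

  sumFin-cong : ∀ {n} {f g : Fin n → ℕ} → (∀ i → f i ≡ g i) → sumFin f ≡ sumFin g
  sumFin-cong {zero}  f≡g = refl
  sumFin-cong {suc n} f≡g = cong₂ _+_ (f≡g zero) (sumFin-cong (λ i → f≡g (suc i)))

  term≤sumFin : ∀ {n} (f : Fin n → ℕ) i → f i ≤ sumFin f
  term≤sumFin f zero    = m≤m+n (f zero) _
  term≤sumFin f (suc i) = ≤-trans (term≤sumFin (λ j → f (suc j)) i) (m≤n+m _ (f zero))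

  joins : ∀ {n} → EdgeLoopSet n → Fin n → Fin n → Bool
  joins T u v = ((u ≤F v) ∧ T u v) ∨ ((v ≤F u) ∧ T v u)

  -- Entrywise containment: stronger than ⊆ₑ, which only sees the entries with i ≤ j.
  _⊑_ : ∀ {n} → EdgeLoopSet n → EdgeLoopSet n → Set
  T ⊑ S = ∀ i j → T i j ⇒ᵇ S i j

  ⊑-∪ˡ : ∀ {n} (T S : EdgeLoopSet n) → T ⊑ (T ∪ₑ S)
  ⊑-∪ˡ T S i j = ∨-true-introˡ (S i j)

  ∩-⊑ˡ : ∀ {n} (T S : EdgeLoopSet n) → (T ∩ₑ S) ⊑ T
  ∩-⊑ˡ T S i j = ∧-conicalˡ (T i j) (S i j)

  ∩-⊑ʳ : ∀ {n} (T S : EdgeLoopSet n) → (T ∩ₑ S) ⊑ S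
  ∩-⊑ʳ T S i j = ∧-conicalʳ (T i j) (S i j)

  joins-mono : ∀ {n} {T S : EdgeLoopSet n} → T ⊑ S → ∀ u v → joins T u v ⇒ᵇ joins S u v
  joins-mono T⊑S u v =
    ∨-mono-⇒ᵇ (∧-monoʳ-⇒ᵇ (u ≤F v) (T⊑S u v)) (∧-monoʳ-⇒ᵇ (v ≤F u) (T⊑S v u))

  joins-∪ : ∀ {n} (T S : EdgeLoopSet n) u v →
    joins (T ∪ₑ S) u v ≡ joins T u v ∨ joins S u v
  joins-∪ T S u v = trans
    (cong₂ _∨_ (∧-distribˡ-∨ (u ≤F v) (T u v) (S u v))
               (∧-distribˡ-∨ (v ≤F u) (T v u) (S v u)))
    (∨-interchange ((u ≤F v) ∧ T u v) _ _ _)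

  incident-mono : ∀ {n} {T S : EdgeLoopSet n} → T ⊑ S → ∀ v → incident T v ⇒ᵇ incident S v
  incident-mono T⊑S v = anyFin-mono (λ u → joins-mono T⊑S u v)

  incident-∪ : ∀ {n} (T S : EdgeLoopSet n) v →
    incident (T ∪ₑ S) v ⇒ᵇ (incident T v ∨ incident S v)
  incident-∪ T S v e = subst (_≡ true) (anyFin-∨ (λ u → joins T u v) (λ u → joins S u v))
    (anyFin-mono (λ u → subst (_≡ true) (joins-∪ T S u v)) e)

  nV-mono : ∀ {n} {T S : EdgeLoopSet n} → T ⊑ S → nV T ≤ nV S
  nV-mono T⊑S = countFin-mono (incident-mono T⊑S)

  nV-∪+nV-∩ : ∀ {n} (T S : EdgeLoopSet n) → nV (T ∪ₑ S) + nV (T ∩ₑ S) ≤ nV T + nV S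
  nV-∪+nV-∩ T S = begin
    nV (T ∪ₑ S) + nV (T ∩ₑ S)
      ≤⟨ +-mono-≤ (countFin-mono (incident-∪ T S)) (countFin-mono incident-∩) ⟩
    countFin (λ v → incident T v ∨ incident S v) + countFin (λ v → incident T v ∧ incident S v)
      ≡⟨ countFin-∨+∧ (incident T) (incident S) ⟩
    nV T + nV S ∎
    where
    open ≤-Reasoning
    incident-∩ : ∀ v → incident (T ∩ₑ S) v ⇒ᵇ (incident T v ∧ incident S v)
    incident-∩ v e =
      cong₂ _∧_ (incident-mono (∩-⊑ˡ T S) v e) (incident-mono (∩-⊑ʳ T S) v e)

  hasLoopᵇ-intro : ∀ {n} {T : EdgeLoopSet n} → HasLoop T → hasLoopᵇ T ≡ true
  hasLoopᵇ-intro {T = T} (v , e) = anyFin-intro (λ v → T v v) v e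

  hasLoopᵇ-mono : ∀ {n} {T S : EdgeLoopSet n} → T ⊑ S → hasLoopᵇ T ⇒ᵇ hasLoopᵇ S
  hasLoopᵇ-mono T⊑S = anyFin-mono (λ v → T⊑S v v)

  hasLoopᵇ-∪ : ∀ {n} (T S : EdgeLoopSet n) → hasLoopᵇ (T ∪ₑ S) ≡ hasLoopᵇ T ∨ hasLoopᵇ S
  hasLoopᵇ-∪ T S = anyFin-∨ (λ v → T v v) (λ v → S v v)

  card-pos : ∀ {n} {T : EdgeLoopSet n} → NonEmpty T → 1 ≤ card T
  card-pos {T = T} (i , j , m) = ≤-trans
    (countFin-pos (λ j → (i ≤F j) ∧ T i j) j m)
    (term≤sumFin (λ i → countFin (λ j → (i ≤F j) ∧ T i j)) i)

  m≤n⇒m*m+n≤n*n+m : ∀ {m n} → m ≤ n → m * m + n ≤ n * n + m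
  m≤n⇒m*m+n≤n*n+m {m} m≤n with m≤n⇒∃[o]m+o≡n m≤n
  ... | o , refl = begin
    m * m + (m + o)              ≡⟨ +-assoc (m * m) m o ⟨
    m * m + m + o                ≤⟨ +-monoʳ-≤ (m * m + m) (n≤n*n o) ⟩
    m * m + m + o * o            ≤⟨ +-monoʳ-≤ (m * m + m) (m≤n+m (o * o) (2 * m * o)) ⟩
    m * m + m + (2 * m * o + o * o) ≡⟨ expand m o ⟩
    (m + o) * (m + o) + m ∎
    where
    open ≤-Reasoning
    n≤n*n : ∀ n → n ≤ n * n
    n≤n*n zero    = z≤n
    n≤n*n (suc n) = m≤m*n (suc n) (suc n)
    expand : ∀ m o → m * m + m + (2 * m * o + o * o) ≡ (m + o) * (m + o) + m
    expand = solve-∀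

  square-bound-mono : ∀ {a m k} → 2 * a + m ≤ m * m → m ≤ k → 2 * a + k ≤ k * k
  square-bound-mono {a} {m} {k} bound m≤k = +-cancelʳ-≤ m _ _ (begin
    2 * a + k + m ≡⟨ [m+n]+o≡[m+o]+n (2 * a) k m ⟩
    2 * a + m + k ≤⟨ +-monoˡ-≤ k bound ⟩
    m * m + k     ≤⟨ m≤n⇒m*m+n≤n*n+m m≤k ⟩
    k * k + m     ∎)
    where open ≤-Reasoning

  square-bound-suc : ∀ {a d c} → d ≤ c → 2 * a + c ≤ c * c →
    2 * (d + a) + suc c ≤ suc c * suc c
  square-bound-suc {a} {d} {c} d≤c bound = begin
    2 * (d + a) + suc c       ≡⟨ regroup d a c ⟩
    2 * d + (2 * a + c) + 1   ≤⟨ +-monoˡ-≤ 1 (+-mono-≤ (*-monoʳ-≤ 2 d≤c) bound) ⟩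
    2 * c + c * c + 1         ≡⟨ square c ⟩
    suc c * suc c             ∎
    where
    open ≤-Reasoning
    regroup : ∀ d a c → 2 * (d + a) + suc c ≡ 2 * d + (2 * a + c) + 1
    regroup = solve-∀
    square : ∀ c → 2 * c + c * c + 1 ≡ suc c * suc c
    square = solve-∀

  -- Not definitional: suc m ≤ᵇ n unfolds to the builtin m <ᵇ n.
  ≤ᵇ-suc : ∀ m n → (suc m ≤ᵇ suc n) ≡ (m ≤ᵇ n)
  ≤ᵇ-suc zero    n = refl
  ≤ᵇ-suc (suc m) n = refl

  dropZero : ∀ {n} → EdgeLoopSet (suc n) → EdgeLoopSet n
  dropZero T i j = T (suc i) (suc j)

  degreeZero : ∀ {n} → EdgeLoopSet (suc n) → ℕ
  degreeZero T = countFin (λ j → T zero (suc j))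

  nVNonZero : ∀ {n} → EdgeLoopSet (suc n) → ℕ
  nVNonZero T = countFin (λ v → incident T (suc v))

  card-dropZero : ∀ {n} (T : EdgeLoopSet (suc n)) → T zero zero ≡ false →
    card T ≡ degreeZero T + card (dropZero T)
  card-dropZero T noLoop rewrite noLoop = cong (degreeZero T +_)
    (sumFin-cong λ i → countFin-cong λ j →
      cong (_∧ T (suc i) (suc j)) (≤ᵇ-suc (toℕ i) (toℕ j)))

  joins-dropZero : ∀ {n} (T : EdgeLoopSet (suc n)) u v →
    joins T (suc u) (suc v) ≡ joins (dropZero T) u v
  joins-dropZero T u v rewrite ≤ᵇ-suc (toℕ u) (toℕ v) | ≤ᵇ-suc (toℕ v) (toℕ u) = refl

  incident-dropZero : ∀ {n} (T : EdgeLoopSet (suc n)) v →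
    incident (dropZero T) v ⇒ᵇ incident T (suc v)
  incident-dropZero T v e = ∨-true-introʳ (joins T zero (suc v))
    (anyFin-mono (λ u → subst (_≡ true) (sym (joins-dropZero T u v))) e)

  incident-from-zero : ∀ {n} (T : EdgeLoopSet (suc n)) v → T zero (suc v) ⇒ᵇ incident T (suc v)
  incident-from-zero T v e = ∨-true-introˡ _ (∨-true-introˡ _ e)

  card-bound-dropZero : ∀ {n} (T : EdgeLoopSet (suc n)) a →
    2 * a + nVNonZero T ≤ nVNonZero T * nVNonZero T →
    2 * (degreeZero T + a) + nV T ≤ nV T * nV T
  card-bound-dropZero T a bound with incident T zero in zero-incident
  ... | true  = square-bound-suc (countFin-mono (incident-from-zero T)) bound
  ... | false rewrite countFin-none (λ j → T zero (suc j)) (∨-conicalʳ _ _ zero-incident) = bound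

  card-loopless-bound : ∀ {n} (T : EdgeLoopSet n) → hasLoopᵇ T ≡ false →
    2 * card T + nV T ≤ nV T * nV T
  card-loopless-bound {zero}  T _ = z≤n
  card-loopless-bound {suc n} T noLoop rewrite card-dropZero T (∨-conicalˡ _ _ noLoop) =
    card-bound-dropZero T (card (dropZero T)) (square-bound-mono {a = card (dropZero T)}
      (card-loopless-bound (dropZero T) (∨-conicalʳ _ _ noLoop))
      (countFin-mono (incident-dropZero T)))

  ≤ᵇ-true : ∀ {m n} → m ≤ n → (m ≤ᵇ n) ≡ true
  ≤ᵇ-true m≤n = Equivalence.to T-≡ (≤⇒≤ᵇ m≤n)

  ≤ᵇ-false : ∀ {m n} → n < m → (m ≤ᵇ n) ≡ false
  ≤ᵇ-false {m} {n} n<m with m ≤ᵇ n in m≤ᵇn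
  ... | true  = ⊥-elim (<⇒≱ n<m (≤ᵇ⇒≤ m n (Equivalence.from T-≡ m≤ᵇn)))
  ... | false = refl

  ≡ᵇ-true : ∀ {m n} → m ≡ n → (m ≡ᵇ n) ≡ true
  ≡ᵇ-true {m} {n} m≡n = Equivalence.to T-≡ (≡⇒≡ᵇ m n m≡n)

  ≡ᵇ-false : ∀ {m n} → m ≢ n → (m ≡ᵇ n) ≡ false
  ≡ᵇ-false {m} {n} m≢n with m ≡ᵇ n in m≡ᵇn
  ... | true  = ⊥-elim (m≢n (≡ᵇ⇒≡ m n (Equivalence.from T-≡ m≡ᵇn)))
  ... | false = refl

  -- f₁ in ℕ: its one subtraction, t·(2t+1) ∸ 1, does not truncate when t ≥ 1 (see f₁≡+f₁ℕ).
  f₁ℕ : ℕ → ∀ {n} → EdgeLoopSet n → ℕ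
  f₁ℕ t T =
    if hasLoopᵇ T then t * nV T
    else if nV T ≤ᵇ (2 * t) then card T
    else if nV T ≡ᵇ suc (2 * t) then t * nV T ∸ 1
    else t * nV T

  1≤t*v : ∀ {t v m} → 1 ≤ t → v ≡ suc m → 1 ≤ t * v
  1≤t*v 1≤t refl = ≤-trans 1≤t (m≤m*n _ (suc _))

  f₁≡+f₁ℕ : ∀ {n} {t} (T : EdgeLoopSet n) → 1 ≤ t → f₁ t T ≡ ℤ.+ f₁ℕ t T
  f₁≡+f₁ℕ {t = t} T 1≤t with hasLoopᵇ T
  ... | true = refl
  ... | false with nV T ≤ᵇ (2 * t)
  ... | true = refl
  ... | false with nV T ≡ᵇ suc (2 * t) in critical
  ... | false = refl
  ... | true  = ⊖-≥ (1≤t*v 1≤t (≡ᵇ⇒≡ _ _ (Equivalence.from T-≡ critical)))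

  Exact : ℕ → ∀ {n} → EdgeLoopSet n → Set
  Exact t T = hasLoopᵇ T ≡ true ⊎ suc (2 * t) < nV T

  Exact-mono : ∀ {n} {t} {T S : EdgeLoopSet n} → T ⊑ S → Exact t T → Exact t S
  Exact-mono T⊑S (inj₁ loop)  = inj₁ (hasLoopᵇ-mono T⊑S loop)
  Exact-mono T⊑S (inj₂ large) = inj₂ (<-≤-trans large (nV-mono T⊑S))

  f₁ℕ-exact : ∀ {n} t (T : EdgeLoopSet n) → Exact t T → f₁ℕ t T ≡ t * nV T
  f₁ℕ-exact t T (inj₁ loop) rewrite loop = refl
  f₁ℕ-exact t T (inj₂ large) with hasLoopᵇ T
  ... | true  = refl
  ... | false rewrite ≤ᵇ-false (<-trans (n<1+n _) large) | ≡ᵇ-false (≢-sym (<⇒≢ large))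
    = refl

  f₁ℕ-small : ∀ {n} t (T : EdgeLoopSet n) →
    hasLoopᵇ T ≡ false → nV T ≤ 2 * t → f₁ℕ t T ≡ card T
  f₁ℕ-small t T noLoop ≤2t rewrite noLoop | ≤ᵇ-true ≤2t = refl

  f₁ℕ-critical : ∀ {n} t (T : EdgeLoopSet n) → 1 ≤ t →
    hasLoopᵇ T ≡ false → nV T ≡ suc (2 * t) → f₁ℕ t T + 1 ≡ t * nV T
  f₁ℕ-critical t T 1≤t noLoop ≡2t+1
    rewrite noLoop | ≤ᵇ-false (≤-reflexive (sym ≡2t+1)) | ≡ᵇ-true ≡2t+1
    = m∸n+n≡m (1≤t*v 1≤t ≡2t+1)

  -- Which clause of f₁ applies; Exact collects the two clauses with value t·|V(T)|.
  data Regime (t : ℕ) {n} (T : EdgeLoopSet n) : Set where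
    exact    : Exact t T → Regime t T
    small    : hasLoopᵇ T ≡ false → nV T ≤ 2 * t → Regime t T
    critical : hasLoopᵇ T ≡ false → nV T ≡ suc (2 * t) → Regime t T

  regime : ∀ t {n} (T : EdgeLoopSet n) → Regime t T
  regime t T with hasLoopᵇ T in loop
  ... | true = exact (inj₁ loop)
  ... | false with <-cmp (nV T) (suc (2 * t))
  ... | tri< lt _ _ = small loop (≤-pred lt)
  ... | tri≈ _ eq _ = critical loop eq
  ... | tri> _ _ gt = exact (inj₂ gt)

  Big : ℕ → ∀ {n} → EdgeLoopSet n → Set
  Big t T = suc (2 * t) ≤ nV T ⊎ HasLoop T

  Big-mono : ∀ {n} {t} {T S : EdgeLoopSet n} → T ⊑ S → Big t T → Big t S
  Big-mono T⊑S (inj₁ large)    = inj₁ (≤-trans large (nV-mono T⊑S))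
  Big-mono T⊑S (inj₂ (v , e)) = inj₂ (v , T⊑S v v e)

  Big-not-small : ∀ {n} t (T : EdgeLoopSet n) →
    Big t T → hasLoopᵇ T ≡ false → ¬ nV T ≤ 2 * t
  Big-not-small t T (inj₁ large) _      ≤2t = <⇒≱ large ≤2t
  Big-not-small t T (inj₂ loop)  noLoop _
    with () ← trans (sym (hasLoopᵇ-intro {T = T} loop)) noLoop

  f₁ℕ-big-≤ : ∀ {n} t (T : EdgeLoopSet n) → 1 ≤ t → Big t T → f₁ℕ t T ≤ t * nV T
  f₁ℕ-big-≤ t T 1≤t big with regime t T
  ... | exact ex          = ≤-reflexive (f₁ℕ-exact t T ex)
  ... | small noLoop s    = ⊥-elim (Big-not-small t T big noLoop s)
  ... | critical noLoop c = ≤-trans (m≤m+n _ 1) (≤-reflexive (f₁ℕ-critical t T 1≤t noLoop c))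

  f₁ℕ-big-≥ : ∀ {n} t (T : EdgeLoopSet n) → 1 ≤ t → Big t T → t * nV T ≤ f₁ℕ t T + 1
  f₁ℕ-big-≥ t T 1≤t big with regime t T
  ... | exact ex          = ≤-trans (≤-reflexive (sym (f₁ℕ-exact t T ex))) (m≤m+n _ 1)
  ... | small noLoop s    = ⊥-elim (Big-not-small t T big noLoop s)
  ... | critical noLoop c = ≤-reflexive (sym (f₁ℕ-critical t T 1≤t noLoop c))

  2≤k : ∀ {a k} → 1 ≤ a → 2 * a + k ≤ k * k → 2 ≤ k
  2≤k {k = 0} 1≤a bound with () ← ≤-trans (+-monoˡ-≤ 0 (*-monoʳ-≤ 2 1≤a)) bound
  2≤k {k = 1} 1≤a bound with s≤s () ← ≤-trans (+-monoˡ-≤ 1 (*-monoʳ-≤ 2 1≤a)) bound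
  2≤k {k = suc (suc k)} _ _ = s≤s (s≤s z≤n)

  4≤k*[1+b] : ∀ {k b} → 2 ≤ k → 4 ≤ k + b → 4 ≤ k * suc b
  4≤k*[1+b] {k} {zero}  _   4≤k rewrite *-identityʳ k | +-identityʳ k = 4≤k
  4≤k*[1+b] {k} {suc b} 2≤k _   = *-mono-≤ 2≤k (s≤s (s≤s z≤n))

  -- 2(a + 2) ≤ k² − k + 4 ≤ 2tk; writing 2t = k + b, the last step is 4 ≤ k(1 + b),
  -- which is where t ≥ 2 enters.
  small-slack : ∀ {t k a} → 2 ≤ t → 1 ≤ a → k ≤ 2 * t → 2 * a + k ≤ k * k → a + 2 ≤ t * k
  small-slack {t} {k} {a} 2≤t 1≤a k≤2t bound with b , k+b≡2t ← m≤n⇒∃[o]m+o≡n k≤2t =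
    *-cancelˡ-≤ 2 (+-cancelʳ-≤ k _ _ (begin
      2 * (a + 2) + k     ≡⟨ regroup a k ⟩
      (2 * a + k) + 4     ≤⟨ +-mono-≤ bound (4≤k*[1+b] (2≤k 1≤a bound) 4≤k+b) ⟩
      k * k + k * suc b   ≡⟨ expand k b ⟩
      (k + b) * k + k     ≡⟨ cong (λ s → s * k + k) k+b≡2t ⟩
      2 * t * k + k       ≡⟨ cong (_+ k) (*-assoc 2 t k) ⟩
      2 * (t * k) + k     ∎))
    where
    open ≤-Reasoning
    regroup : ∀ a k → 2 * (a + 2) + k ≡ (2 * a + k) + 4
    regroup = solve-∀
    expand : ∀ k b → k * k + k * suc b ≡ (k + b) * k + k
    expand = solve-∀
    4≤k+b : 4 ≤ k + b
    4≤k+b = subst (4 ≤_) (sym k+b≡2t) (*-monoʳ-≤ 2 2≤t)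

  nV-∪≡s : ∀ {n} {s} (T S : EdgeLoopSet n) →
    nV T ≡ s → nV S ≡ s → nV (T ∩ₑ S) ≡ s → nV (T ∪ₑ S) ≡ s
  nV-∪≡s {s = s} T S refl nVS≡s nVI≡s = ≤-antisym
    (+-cancelʳ-≤ s _ _
      (subst₂ (λ i j → nV (T ∪ₑ S) + i ≤ nV T + j) nVI≡s nVS≡s (nV-∪+nV-∩ T S)))
    (nV-mono (⊑-∪ˡ T S))

  module _ {n} {t} (2≤t : 2 ≤ t) (T₁ T₂ : EdgeLoopSet n)
           (big₁ : Big t T₁) (big₂ : Big t T₂) where
    private
      U I : EdgeLoopSet n
      U = T₁ ∪ₑ T₂
      I = T₁ ∩ₑ T₂

      1≤t : 1 ≤ t
      1≤t = <⇒≤ 2≤t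

      -- a, b bound the defects t·|V| − f₁ of U and I from below, c, d those of T₁, T₂ from above.
      combine : ∀ {a b c d} → f₁ℕ t U + a ≤ t * nV U → f₁ℕ t I + b ≤ t * nV I →
        t * nV T₁ ≤ f₁ℕ t T₁ + c → t * nV T₂ ≤ f₁ℕ t T₂ + d → c + d ≤ a + b →
        f₁ℕ t U + f₁ℕ t I ≤ f₁ℕ t T₁ + f₁ℕ t T₂
      combine {a} {b} {c} {d} upperU upperI lower₁ lower₂ c+d≤a+b =
        +-cancelʳ-≤ (a + b) _ _ (begin
        f₁ℕ t U + f₁ℕ t I + (a + b)      ≡⟨ +-interchange (f₁ℕ t U) (f₁ℕ t I) a b ⟩
        (f₁ℕ t U + a) + (f₁ℕ t I + b)    ≤⟨ +-mono-≤ upperU upperI ⟩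
        t * nV U + t * nV I              ≡⟨ *-distribˡ-+ t (nV U) (nV I) ⟨
        t * (nV U + nV I)                ≤⟨ *-monoʳ-≤ t (nV-∪+nV-∩ T₁ T₂) ⟩
        t * (nV T₁ + nV T₂)              ≡⟨ *-distribˡ-+ t (nV T₁) (nV T₂) ⟩
        t * nV T₁ + t * nV T₂            ≤⟨ +-mono-≤ lower₁ lower₂ ⟩
        (f₁ℕ t T₁ + c) + (f₁ℕ t T₂ + d)  ≡⟨ +-interchange (f₁ℕ t T₁) c (f₁ℕ t T₂) d ⟩
        f₁ℕ t T₁ + f₁ℕ t T₂ + (c + d)    ≤⟨ +-monoʳ-≤ (f₁ℕ t T₁ + f₁ℕ t T₂) c+d≤a+b ⟩
        f₁ℕ t T₁ + f₁ℕ t T₂ + (a + b)    ∎)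
        where open ≤-Reasoning

      exact-upper : ∀ (X : EdgeLoopSet n) → Exact t X → f₁ℕ t X + 0 ≤ t * nV X
      exact-upper X ex = ≤-reflexive (trans (+-identityʳ _) (f₁ℕ-exact t X ex))

      exact-lower : ∀ (X : EdgeLoopSet n) → Exact t X → t * nV X ≤ f₁ℕ t X + 0
      exact-lower X ex = ≤-reflexive (sym (trans (+-identityʳ _) (f₁ℕ-exact t X ex)))

      upper-∪ : f₁ℕ t U + 0 ≤ t * nV U
      upper-∪ = subst (_≤ t * nV U) (sym (+-identityʳ _))
        (f₁ℕ-big-≤ t U 1≤t (Big-mono {t = t} (⊑-∪ˡ T₁ T₂) big₁))

      critical-upper : ∀ (X : EdgeLoopSet n) → hasLoopᵇ X ≡ false → nV X ≡ suc (2 * t) →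
        f₁ℕ t X + 1 ≤ t * nV X
      critical-upper X noLoop c = ≤-reflexive (f₁ℕ-critical t X 1≤t noLoop c)

    submodular-exact : Exact t I → f₁ℕ t U + f₁ℕ t I ≤ f₁ℕ t T₁ + f₁ℕ t T₂
    submodular-exact ex = combine upper-∪ (exact-upper I ex)
      (exact-lower T₁ (Exact-mono {t = t} (∩-⊑ˡ T₁ T₂) ex))
      (exact-lower T₂ (Exact-mono {t = t} (∩-⊑ʳ T₁ T₂) ex)) ≤-refl

    submodular-small : NonEmpty I → hasLoopᵇ I ≡ false → nV I ≤ 2 * t →
      f₁ℕ t U + f₁ℕ t I ≤ f₁ℕ t T₁ + f₁ℕ t T₂
    submodular-small nonEmpty noLoop ≤2t = combine upper-∪ slack
      (f₁ℕ-big-≥ t T₁ 1≤t big₁) (f₁ℕ-big-≥ t T₂ 1≤t big₂) ≤-refl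
      where
      slack : f₁ℕ t I + 2 ≤ t * nV I
      slack rewrite f₁ℕ-small t I noLoop ≤2t =
        small-slack 2≤t (card-pos nonEmpty) ≤2t (card-loopless-bound I noLoop)

    submodular-critical : hasLoopᵇ I ≡ false → nV I ≡ suc (2 * t) →
      f₁ℕ t U + f₁ℕ t I ≤ f₁ℕ t T₁ + f₁ℕ t T₂
    submodular-critical noLoop c with regime t T₁ | regime t T₂
    ... | exact ex₁ | _ = combine upper-∪ (critical-upper I noLoop c)
      (exact-lower T₁ ex₁) (f₁ℕ-big-≥ t T₂ 1≤t big₂) ≤-refl
    ... | _ | exact ex₂ = combine upper-∪ (critical-upper I noLoop c)
      (f₁ℕ-big-≥ t T₁ 1≤t big₁) (exact-lower T₂ ex₂) ≤-refl
    ... | small noLoop₁ ≤2t₁ | _ = ⊥-elim (Big-not-small t T₁ big₁ noLoop₁ ≤2t₁)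
    ... | _ | small noLoop₂ ≤2t₂ = ⊥-elim (Big-not-small t T₂ big₂ noLoop₂ ≤2t₂)
    ... | critical noLoop₁ c₁ | critical noLoop₂ c₂ = combine
      (critical-upper U (trans (hasLoopᵇ-∪ T₁ T₂) (cong₂ _∨_ noLoop₁ noLoop₂))
                        (nV-∪≡s T₁ T₂ c₁ c₂ c))
      (critical-upper I noLoop c)
      (f₁ℕ-big-≥ t T₁ 1≤t big₁) (f₁ℕ-big-≥ t T₂ 1≤t big₂) ≤-refl

  f₁ℕ-submodular : ∀ {n} {t} → 2 ≤ t → (T₁ T₂ : EdgeLoopSet n) → Big t T₁ → Big t T₂ →
    NonEmpty (T₁ ∩ₑ T₂) → f₁ℕ t (T₁ ∪ₑ T₂) + f₁ℕ t (T₁ ∩ₑ T₂) ≤ f₁ℕ t T₁ + f₁ℕ t T₂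
  f₁ℕ-submodular {t = t} 2≤t T₁ T₂ big₁ big₂ nonEmpty with regime t (T₁ ∩ₑ T₂)
  ... | exact ex          = submodular-exact 2≤t T₁ T₂ big₁ big₂ ex
  ... | small noLoop ≤2t  = submodular-small 2≤t T₁ T₂ big₁ big₂ nonEmpty noLoop ≤2t
  ... | critical noLoop c = submodular-critical 2≤t T₁ T₂ big₁ big₂ noLoop c

open import Data.Integer using (_+_; _≥_; +≤+)
open import Data.Nat.Properties using (<⇒≤)

lemma3p3 : (n : ℕ) (G : EdgeLoopSet n) (t : ℕ) → 1 < t →
    (T₁ T₂ : EdgeLoopSet n) → T₁ ⊆ₑ G → T₂ ⊆ₑ G →
    (suc (2 * t) ≤ nV T₁ ⊎ HasLoop T₁) →
    (suc (2 * t) ≤ nV T₂ ⊎ HasLoop T₂) →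
    NonEmpty (T₁ ∩ₑ T₂) →
    f₁ t T₁ + f₁ t T₂ ≥ f₁ t (T₁ ∪ₑ T₂) + f₁ t (T₁ ∩ₑ T₂)
lemma3p3 n G t 1<t T₁ T₂ _ _ big₁ big₂ nonEmpty
  rewrite f₁≡+f₁ℕ T₁ (<⇒≤ 1<t) | f₁≡+f₁ℕ T₂ (<⇒≤ 1<t)
        | f₁≡+f₁ℕ (T₁ ∪ₑ T₂) (<⇒≤ 1<t) | f₁≡+f₁ℕ (T₁ ∩ₑ T₂) (<⇒≤ 1<t)
  = +≤+ (f₁ℕ-submodular 1<t T₁ T₂ big₁ big₂ nonEmpty)
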